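{- Let $G=(V,E)$ be a finite simple graph and let $v\in V$. Then \[ Q(G;x,y)=Q(G-v;x,y)+x(y-1)\,Q(G-N[v];x,y)+x\,Q(G/v;x,y). \]
   Context: All graphs are finite, simple and undirected. For a graph $G=(V,E)$ and $X\subseteq V$, $G[X]$ denotes the subgraph induced by $X$, and $k(H)$ denotes the number of connected components of a graph $H$, where the null graph (no vertices) has $k=0$. The subgraph component polynomial is $Q(G;x,y)=\sum_{X\subseteq V}x^{|X|}y^{k(G[X])}$. For $v\in V$: $G-v$ is obtained by removing $v$ and all edges incident to it; $N[v]$ is the closed neighbourhood of $v$ (its neighbours together with $v$), and $G-N[v]$ is obtained by removing all vertices of $N[v]$; $G/v$ (vertex contraction) is obtained from $G$ by removing $v$ and inserting an edge between every pair of non-adjacent neighbours of $v$. -}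

module Defs where

open import Data.Bool using (Bool; true; false; _∧_; _∨_; not; if_then_else_)
open import Data.Bool.Properties using (∧-comm; ∧-assoc)
open import Data.Nat using (ℕ; zero; suc; _≡ᵇ_; _<ᵇ_)
open import Data.Integer using (ℤ; +_; _+_; _-_)
open import Data.Fin using (Fin; toℕ; _≟_)
open import Data.Vec using (Vec; []; _∷_; lookup; tabulate)
open import Data.List using (List; []; _∷_; _++_; map; filter; length)
open import Data.Fin.Subset using (Subset)
open import Relation.Nullary.Decidable using (⌊_⌋)
open import Relation.Binary.PropositionalEquality using (_≡_; refl)
open import Function using (_∘_)
open import Relation.Nullary using (yes; no)
open import Data.Empty using (⊥-elim)
open import Relation.Binary.PropositionalEquality using () renaming (sym to ≡-sym)

-- A graph lives on an ambient finite set Fin n; its vertex set is the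
-- subset V ⊆ Fin n, and the (symmetric, loopless) adjacency relation
-- is only ever consulted between vertices of V.

record Graph (n : ℕ) : Set where
  field
    V      : Subset n
    adj    : Fin n → Fin n → Bool
    adj-sym : ∀ a b → adj a b ≡ adj b a
    adj-irrefl : ∀ a → adj a a ≡ false

open Graph public

_∈ᵇ_ : ∀ {n} → Fin n → Subset n → Bool
a ∈ᵇ S = lookup S a

_==_ : ∀ {n} → Fin n → Fin n → Bool
a == b = ⌊ a ≟ b ⌋

anyFin : ∀ {n} → (Fin n → Bool) → Bool
anyFin {zero}  p = false
anyFin {suc n} p = p Fin.zero ∨ anyFin {n} (p ∘ Fin.suc)

allFin : ∀ {n} → (Fin n → Bool) → Bool
allFin p = not (anyFin (not ∘ p))

size : ∀ {n} → Subset n → ℕ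
size []          = 0
size (true ∷ S)  = suc (size S)
size (false ∷ S) = size S

_⊆ᵇ_ : ∀ {n} → Subset n → Subset n → Bool
X ⊆ᵇ S = allFin (λ a → not (a ∈ᵇ X) ∨ (a ∈ᵇ S))

subsets : (n : ℕ) → List (Subset n)
subsets zero    = [] ∷ []
subsets (suc n) = map (true ∷_) (subsets n) ++ map (false ∷_) (subsets n)

step : ∀ {n} → (Fin n → Fin n → Bool) → Subset n → Subset n → Subset n
step adj' X R = tabulate λ b →
  (b ∈ᵇ R) ∨ ((b ∈ᵇ X) ∧ anyFin (λ a → (a ∈ᵇ R) ∧ adj' a b))

iter : ∀ {A : Set} → ℕ → (A → A) → A → A
iter zero    f a = a
iter (suc k) f a = f (iter k f a)

-- set of vertices reachable from a by a walk inside X (for a ∈ X);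
-- n closure steps suffice since walks need at most n-1 edges.
reach : ∀ {n} → (Fin n → Fin n → Bool) → Subset n → Fin n → Subset n
reach {n} adj' X a = iter n (step adj' X) (tabulate (λ b → b == a))

isRep : ∀ {n} → (Fin n → Fin n → Bool) → Subset n → Fin n → Bool
isRep adj' X a =
  (a ∈ᵇ X) ∧ allFin (λ b → not ((toℕ b <ᵇ toℕ a) ∧ (b ∈ᵇ reach adj' X a)))

-- k(G[X]) = number of connected components (0 for the null graph)
k : ∀ {n} → Graph n → Subset n → ℕ
k {n} G X = length (filter (λ a → isRep (adj G) X a ≟B true) (Data.List.allFin n))
  where
    open import Data.Bool using () renaming (_≟_ to _≟B_)
    import Data.List

-- Polynomials in ℤ[x,y], represented by their coefficient functions:
-- p i j is the coefficient of x^i y^j.  Equality of polynomials is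
-- equality of all coefficients.

Poly : Set
Poly = ℕ → ℕ → ℤ

_⊕_ : Poly → Poly → Poly
(p ⊕ q) i j = p i j + q i j

_⊖_ : Poly → Poly → Poly
(p ⊖ q) i j = p i j - q i j

mulX : Poly → Poly
mulX p zero    j = + 0
mulX p (suc i) j = p i j

mulY : Poly → Poly
mulY p i zero    = + 0
mulY p i (suc j) = p i j

infixl 6 _⊕_ _⊖_

-- Subgraph component polynomial:
-- Q(G;x,y) = Σ_{X ⊆ V} x^|X| y^k(G[X]); its (i,j) coefficient is the
-- number of X ⊆ V with |X| = i and k(G[X]) = j.
Q : ∀ {n} → Graph n → Poly
Q {n} G i j = + length (filter (λ X → cond X ≟B true) (subsets n))
  where
    open import Data.Bool using () renaming (_≟_ to _≟B_)
    cond : Subset n → Bool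
    cond X = (X ⊆ᵇ V G) ∧ (size X ≡ᵇ i) ∧ (k G X ≡ᵇ j)

removeSet : ∀ {n} → Subset n → (Fin n → Bool) → Subset n
removeSet S r = tabulate λ a → (a ∈ᵇ S) ∧ not (r a)

_-v_ : ∀ {n} → Graph n → Fin n → Graph n
G -v v = record G { V = removeSet (V G) (λ a → a == v) }

_-N[_] : ∀ {n} → Graph n → Fin n → Graph n
G -N[ v ] = record G
  { V = removeSet (V G) (λ a → (a == v) ∨ ((a ∈ᵇ V G) ∧ adj G v a)) }

contrAdj : ∀ {n} → Graph n → Fin n → Fin n → Fin n → Bool
contrAdj G v a b =
  adj G a b ∨ (adj G v a ∧ adj G v b ∧ not (a == b))

private
  ==-sym : ∀ {n} (a b : Fin n) → (a == b) ≡ (b == a)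
  ==-sym a b with a ≟ b | b ≟ a
  ... | yes _ | yes _ = refl
  ... | no _  | no _  = refl
  ... | yes p | no q  = ⊥-elim (q (≡-sym p))
  ... | no q  | yes p = ⊥-elim (q (≡-sym p))

  ==-refl : ∀ {n} (a : Fin n) → (a == a) ≡ true
  ==-refl a with a ≟ a
  ... | yes _ = refl
  ... | no q  = ⊥-elim (q refl)

  contr-sym : ∀ {n} (G : Graph n) v a b → contrAdj G v a b ≡ contrAdj G v b a
  contr-sym G v a b
    rewrite Graph.adj-sym G a b | ==-sym a b
    with adj G v a | adj G v b
  ... | true  | true  = refl
  ... | true  | false = refl
  ... | false | true  = refl
  ... | false | false = refl

  contr-irrefl : ∀ {n} (G : Graph n) v a → contrAdj G v a a ≡ false
  contr-irrefl G v a rewrite Graph.adj-irrefl G a | ==-refl a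
    with adj G v a
  ... | true  = refl
  ... | false = refl

_/_ : ∀ {n} → Graph n → Fin n → Graph n
G / v = record
  { V      = removeSet (V G) (λ a → a == v)
  ; adj    = contrAdj G v
  ; adj-sym = contr-sym G v
  ; adj-irrefl = contr-irrefl G v
  }

module Submission where

-- Split the vertex sets X of G by whether v ∈ X.  Those avoiding
-- v are exactly the vertex sets of G - v.  Those containing v are Y ∪ {v}
-- with Y a vertex set of G - v, and
--   * if Y meets N(v), then k(G[Y ∪ {v}]) = k((G/v)[Y]): a walk through v in
--     G[Y ∪ {v}] is an edge of G/v and conversely, and v joins a component
--     that already meets Y;
--   * otherwise v is isolated in G[Y ∪ {v}], so k(G[Y ∪ {v}]) = k(G[Y]) + 1;
--     such Y are the vertex sets of G - N[v], on which G/v and G agree.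
-- So the first kind contributes x (Q(G/v) - Q(G - N[v])) and the second
-- x y Q(G - N[v]).

open import Defs
open import Data.Bool using (Bool; true; false; _∧_; _∨_; not) renaming (_≟_ to _≟ᵇ_)
open import Data.Bool.Properties using (T-≡; not-involutive; ∨-identityʳ; ∧-zeroʳ; ∧-assoc)
open import Data.Nat as ℕ using (ℕ; zero; suc; _+_; _≤_; z≤n; s≤s; _<ᵇ_; _≡ᵇ_)
open import Data.Nat.Properties as ℕ using (≤-refl; <-≤-trans; m≤n⇒m≤1+n; <ᵇ⇒<; <⇒<ᵇ)
open import Algebra.Properties.CommutativeSemigroup ℕ.+-commutativeSemigroup using (x∙yz≈y∙xz; interchange)
open import Data.Fin as Fin using (Fin; toℕ; _≟_; _<_)
open import Data.Fin.Properties using (<-cmp; <⇒≢; <-trans)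
open import Relation.Binary.Definitions using (tri<; tri≈; tri>)
open import Data.Fin.Subset using (Subset)
open import Data.List as List using (length; filter)
open import Data.List.Properties using (filter-++; length-++)
open import Data.Integer using () renaming (+_ to pos; _+_ to _+ℤ_; _-_ to _-ℤ_)
open import Data.Integer.Properties as ℤ using (pos-+)
open import Data.Integer.Tactic.RingSolver using (solve-∀)
open import Data.Vec using ([]; _∷_; tabulate; _[_]≔_)
open import Data.Vec.Properties using (lookup∘tabulate; lookup∘update; lookup∘update′)
open import Data.Product using (Σ; _,_; _×_; proj₁; proj₂)
open import Data.Sum using (_⊎_; inj₁; inj₂)
open import Data.Empty using (⊥; ⊥-elim)
open import Function using (id; _∘_; Equivalence)
open import Relation.Nullary using (Dec; yes; no; ¬_)
open import Relation.Unary using (Decidable)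
open import Relation.Binary.PropositionalEquality

∧-true⁻ : ∀ {a b} → a ∧ b ≡ true → a ≡ true × b ≡ true
∧-true⁻ {true} e = refl , e

∧-true⁺ : ∀ {a b} → a ≡ true → b ≡ true → a ∧ b ≡ true
∧-true⁺ refl refl = refl

∨-true⁻ : ∀ {a b} → a ∨ b ≡ true → a ≡ true ⊎ b ≡ true
∨-true⁻ {true}  _ = inj₁ refl
∨-true⁻ {false} e = inj₂ e

∨-trueˡ : ∀ {a b} → a ≡ true → a ∨ b ≡ true
∨-trueˡ refl = refl

∨-trueʳ : ∀ {a b} → b ≡ true → a ∨ b ≡ true
∨-trueʳ {true}  _ = refl
∨-trueʳ {false} e = e

not-true⁻ : ∀ {a} → not a ≡ true → a ≡ false
not-true⁻ {false} _ = refl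

not-false⁻ : ∀ {a} → not a ≡ false → a ≡ true
not-false⁻ {true} _ = refl

not-true⁺ : ∀ {a} → a ≡ false → not a ≡ true
not-true⁺ refl = refl

true≢false : ∀ {a} → a ≡ true → a ≡ false → ⊥
true≢false refl ()

false-if-not-true : ∀ {a} → ¬ (a ≡ true) → a ≡ false
false-if-not-true {true}  h = ⊥-elim (h refl)
false-if-not-true {false} _ = refl

bool-ext : ∀ {a b} → (a ≡ true → b ≡ true) → (b ≡ true → a ≡ true) → a ≡ b
bool-ext {true}  {_}     f _ = sym (f refl)
bool-ext {false} {true}  _ g = g refl
bool-ext {false} {false} _ _ = refl

∧-cong-if : ∀ a {b c} → (a ≡ true → b ≡ c) → a ∧ b ≡ a ∧ c
∧-cong-if true  h = h refl
∧-cong-if false _ = refl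

∧-absorb : ∀ {a b} → (b ≡ true → a ≡ true) → a ∧ b ≡ b
∧-absorb {b = true}  h = cong (_∧ true) (h refl)
∧-absorb {a} {false} _ = ∧-zeroʳ a

false-at-end : ∀ a b c → a ∧ b ∧ c ∧ false ≡ false
false-at-end false _ _ = refl
false-at-end true false _ = refl
false-at-end true true c = ∧-zeroʳ c

bool-cases : ∀ b → b ≡ true ⊎ b ≡ false
bool-cases true  = inj₁ refl
bool-cases false = inj₂ refl

==-true⁻ : ∀ {n} {a b : Fin n} → (a == b) ≡ true → a ≡ b
==-true⁻ {a = a} {b} e with a ≟ b
... | yes a≡b = a≡b

==-refl : ∀ {n} (a : Fin n) → (a == a) ≡ true
==-refl a with a ≟ a
... | yes _  = refl
... | no a≢a = ⊥-elim (a≢a refl)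

==-false : ∀ {n} {a b : Fin n} → ¬ a ≡ b → (a == b) ≡ false
==-false {a = a} {b} a≢b with a ≟ b
... | yes a≡b = ⊥-elim (a≢b a≡b)
... | no _    = refl

==-suc : ∀ {n} (a b : Fin n) → (Fin.suc a == Fin.suc b) ≡ (a == b)
==-suc a b with a ≟ b
... | yes refl = refl
... | no _     = refl

infix 4 _∈_ _∉_
_∈_ _∉_ : ∀ {n} → Fin n → Subset n → Set
a ∈ X = (a ∈ᵇ X) ≡ true
a ∉ X = (a ∈ᵇ X) ≡ false

∈-tabulate : ∀ {n} (p : Fin n → Bool) a → (a ∈ᵇ tabulate p) ≡ p a
∈-tabulate = lookup∘tabulate

anyFin⁻ : ∀ {n} (p : Fin n → Bool) → anyFin p ≡ true → Σ (Fin n) λ a → p a ≡ true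
anyFin⁻ {suc n} p e with ∨-true⁻ {p Fin.zero} e
... | inj₁ p0 = Fin.zero , p0
... | inj₂ ps with anyFin⁻ (p ∘ Fin.suc) ps
...   | a , pa = Fin.suc a , pa

anyFin⁺ : ∀ {n} (p : Fin n → Bool) a → p a ≡ true → anyFin p ≡ true
anyFin⁺ p Fin.zero    e = ∨-trueˡ e
anyFin⁺ p (Fin.suc a) e = ∨-trueʳ {p Fin.zero} (anyFin⁺ (p ∘ Fin.suc) a e)

allFin⁻ : ∀ {n} (p : Fin n → Bool) → allFin p ≡ true → ∀ a → p a ≡ true
allFin⁻ p e a with p a in pa
... | true  = refl
... | false = ⊥-elim (true≢false (anyFin⁺ (not ∘ p) a (cong not pa)) (not-true⁻ e))

allFin⁺ : ∀ {n} (p : Fin n → Bool) → (∀ a → p a ≡ true) → allFin p ≡ true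
allFin⁺ p h with anyFin (not ∘ p) in e
... | false = refl
... | true with anyFin⁻ (not ∘ p) e
...   | a , npa = ⊥-elim (true≢false (h a) (not-true⁻ npa))

anyFin-cong : ∀ {n} {p q : Fin n → Bool} → (∀ a → p a ≡ q a) → anyFin p ≡ anyFin q
anyFin-cong {zero}  h = refl
anyFin-cong {suc n} h = cong₂ _∨_ (h Fin.zero) (anyFin-cong (h ∘ Fin.suc))

allFin-cong : ∀ {n} {p q : Fin n → Bool} → (∀ a → p a ≡ q a) → allFin p ≡ allFin q
allFin-cong h = cong not (anyFin-cong (cong not ∘ h))

least : ∀ {n} (q : Fin n → Bool) u → q u ≡ true →
  Σ (Fin n) λ w → q w ≡ true × (∀ b → b < w → q b ≡ false)
least {suc n} q u qu with q Fin.zero in q0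
... | true = Fin.zero , q0 , λ _ ()
... | false with u
...   | Fin.zero = ⊥-elim (true≢false qu q0)
...   | Fin.suc u′ with least (q ∘ Fin.suc) u′ qu
...     | w , qw , below = Fin.suc w , qw , below′
  where
  below′ : ∀ b → b < Fin.suc w → q b ≡ false
  below′ Fin.zero    _         = q0
  below′ (Fin.suc b) (s≤s b<w) = below b b<w

_⊆_ : ∀ {n} → Subset n → Subset n → Set
R ⊆ S = ∀ b → b ∈ R → b ∈ S

size≤n : ∀ {n} (S : Subset n) → size S ≤ n
size≤n []          = z≤n
size≤n (true ∷ S)  = s≤s (size≤n S)
size≤n (false ∷ S) = m≤n⇒m≤1+n (size≤n S)

size>0 : ∀ {n} (S : Subset n) a → a ∈ S → 0 ℕ.< size S
size>0 (true  ∷ S) a           _ = s≤s z≤n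
size>0 (false ∷ S) (Fin.suc a) e = size>0 S a e

⊆⇒≡⊎size< : ∀ {n} (R S : Subset n) → R ⊆ S → R ≡ S ⊎ size R ℕ.< size S
⊆⇒≡⊎size< [] [] _ = inj₁ refl
⊆⇒≡⊎size< (x ∷ R) (y ∷ S) R⊆S with ⊆⇒≡⊎size< R S (R⊆S ∘ Fin.suc)
⊆⇒≡⊎size< (true  ∷ R) (false ∷ S) R⊆S | _        = ⊥-elim (true≢false (R⊆S Fin.zero refl) refl)
⊆⇒≡⊎size< (true  ∷ R) (true  ∷ S) _   | inj₁ refl = inj₁ refl
⊆⇒≡⊎size< (false ∷ R) (false ∷ S) _   | inj₁ refl = inj₁ refl
⊆⇒≡⊎size< (false ∷ R) (true  ∷ S) _   | inj₁ refl = inj₂ ≤-refl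
⊆⇒≡⊎size< (true  ∷ R) (true  ∷ S) _   | inj₂ lt   = inj₂ (s≤s lt)
⊆⇒≡⊎size< (false ∷ R) (false ∷ S) _   | inj₂ lt   = inj₂ lt
⊆⇒≡⊎size< (false ∷ R) (true  ∷ S) _   | inj₂ lt   = inj₂ (ℕ.<-trans lt (s≤s ≤-refl))

insert : ∀ {n} → Fin n → Subset n → Subset n
insert v Y = Y [ v ]≔ true

∈-insert-self : ∀ {n} (v : Fin n) Y → v ∈ insert v Y
∈-insert-self v Y = lookup∘update v Y true

⊆-insert : ∀ {n} (v : Fin n) Y → Y ⊆ insert v Y
⊆-insert v Y a a∈Y with a ≟ v
... | yes refl = ∈-insert-self v Y
... | no  a≢v  = trans (lookup∘update′ a≢v Y true) a∈Y

∈-insert⁻ : ∀ {n} (v : Fin n) Y a → a ∈ insert v Y → ¬ a ≡ v → a ∈ Y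
∈-insert⁻ v Y a a∈ a≢v = trans (sym (lookup∘update′ a≢v Y true)) a∈

∉-insert : ∀ {n} (v : Fin n) Y a → ¬ a ≡ v → a ∉ Y → a ∉ insert v Y
∉-insert v Y a a≢v a∉Y = trans (lookup∘update′ a≢v Y true) a∉Y

⊆ᵇ⁻ : ∀ {n} (X S : Subset n) → (X ⊆ᵇ S) ≡ true → X ⊆ S
⊆ᵇ⁻ X S X⊆S a a∈X with ∨-true⁻ (allFin⁻ _ X⊆S a)
... | inj₁ a∉X = ⊥-elim (true≢false a∈X (not-true⁻ a∉X))
... | inj₂ a∈S = a∈S

⊆ᵇ⁺ : ∀ {n} (X S : Subset n) → X ⊆ S → (X ⊆ᵇ S) ≡ true
⊆ᵇ⁺ X S X⊆S = allFin⁺ _ λ a → case a (bool-cases (a ∈ᵇ X))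
  where
  case : ∀ a → a ∈ X ⊎ a ∉ X → (not (a ∈ᵇ X) ∨ _) ≡ true
  case a (inj₁ a∈X) = ∨-trueʳ {not (a ∈ᵇ X)} (X⊆S a a∈X)
  case a (inj₂ a∉X) = ∨-trueˡ (not-true⁺ a∉X)

∈-removeSet : ∀ {n} (S : Subset n) r a → (a ∈ᵇ removeSet S r) ≡ (a ∈ᵇ S) ∧ not (r a)
∈-removeSet S r = ∈-tabulate _

-- Reachability inside a vertex set X for an adjacency A.  `reach A X a`
-- iterates `step` n times from {a}; since every non-final step adds a vertex,
-- the result is a fixed point of `step`, and so it is the least set that
-- contains a and is closed under A-edges into X.

Closed : ∀ {n} → (Fin n → Fin n → Bool) → Subset n → (Fin n → Bool) → Set
Closed A X S = ∀ b c → S b ≡ true → c ∈ X → A b c ≡ true → S c ≡ true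

Reach : ∀ {n} → (Fin n → Fin n → Bool) → Subset n → Fin n → Fin n → Bool
Reach A X a b = b ∈ᵇ reach A X a

module Reachability {n : ℕ} (A : Fin n → Fin n → Bool) (X : Subset n) where

  start : Fin n → Subset n
  start a = tabulate (λ b → b == a)

  stage : ℕ → Fin n → Subset n
  stage m a = iter m (step A X) (start a)

  ∈-step : ∀ R b →
    (b ∈ᵇ step A X R) ≡ ((b ∈ᵇ R) ∨ ((b ∈ᵇ X) ∧ anyFin (λ c → (c ∈ᵇ R) ∧ A c b)))
  ∈-step R b = ∈-tabulate _ b

  step-⊇ : ∀ R → R ⊆ step A X R
  step-⊇ R b b∈R rewrite ∈-step R b = ∨-trueˡ b∈R

  stage-self : ∀ m a → a ∈ stage m a
  stage-self zero    a = trans (∈-tabulate _ a) (==-refl a)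
  stage-self (suc m) a = step-⊇ (stage m a) a (stage-self m a)

  stage-least : ∀ (S : Fin n → Bool) → Closed A X S → ∀ a → S a ≡ true →
                ∀ m b → b ∈ stage m a → S b ≡ true
  stage-least S closed a Sa zero b b∈
    rewrite ==-true⁻ {a = b} {a} (trans (sym (∈-tabulate _ b)) b∈) = Sa
  stage-least S closed a Sa (suc m) b b∈ rewrite ∈-step (stage m a) b with ∨-true⁻ b∈
  ... | inj₁ old = stage-least S closed a Sa m b old
  ... | inj₂ new with ∧-true⁻ new
  ...   | b∈X , edge with anyFin⁻ _ edge
  ...     | c , c∈∧Acb with ∧-true⁻ {c ∈ᵇ stage m a} c∈∧Acb
  ...       | c∈ , Acb = closed c b (stage-least S closed a Sa m c c∈) b∈X Acb

  stage-grows : ∀ m a → stage m a ≡ step A X (stage m a) ⊎ m ℕ.< size (stage m a)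
  stage-grows zero    a = inj₂ (size>0 (start a) a (stage-self zero a))
  stage-grows (suc m) a with stage-grows m a
  ... | inj₁ fixed = inj₁ (cong (step A X) fixed)
  ... | inj₂ m<size with ⊆⇒≡⊎size< (stage m a) (stage (suc m) a) (step-⊇ (stage m a))
  ...   | inj₁ fixed = inj₁ (cong (step A X) fixed)
  ...   | inj₂ grown = inj₂ (<-≤-trans (s≤s m<size) grown)

  reach-fixed : ∀ a → reach A X a ≡ step A X (reach A X a)
  reach-fixed a with stage-grows n a
  ... | inj₁ fixed = fixed
  ... | inj₂ n<size = ⊥-elim (ℕ.<-irrefl refl (<-≤-trans n<size (size≤n (reach A X a))))

  reach-self : ∀ a → Reach A X a a ≡ true
  reach-self = stage-self n

  reach-least : ∀ (S : Fin n → Bool) → Closed A X S → ∀ a → S a ≡ true →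
                ∀ b → Reach A X a b ≡ true → S b ≡ true
  reach-least S closed a Sa = stage-least S closed a Sa n

  reach-closed : ∀ a → Closed A X (Reach A X a)
  reach-closed a b c b∈ c∈X Abc = subst (λ R → c ∈ R) (sym (reach-fixed a))
    (subst (_≡ true) (sym (∈-step (reach A X a) c))
      (∨-trueʳ {c ∈ᵇ reach A X a}
        (∧-true⁺ c∈X (anyFin⁺ (λ d → (d ∈ᵇ reach A X a) ∧ A d c) b (∧-true⁺ b∈ Abc)))))

  reach-trans : ∀ a b c → Reach A X a b ≡ true → Reach A X b c ≡ true → Reach A X a c ≡ true
  reach-trans a b c ab = reach-least (Reach A X a) (reach-closed a) b ab c

  reach-stays : ∀ a b → a ∈ X → Reach A X a b ≡ true → b ∈ X
  reach-stays a b a∈X = reach-least (_∈ᵇ X) (λ _ _ _ c∈X _ → c∈X) a a∈X b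

  reach-sym : (∀ a b → A a b ≡ A b a) →
              ∀ a b → a ∈ X → Reach A X a b ≡ true → Reach A X b a ≡ true
  reach-sym A-sym a b a∈X =
    proj₂ ∘ ∧-true⁻ ∘ reach-least back closed a (∧-true⁺ a∈X (reach-self a)) b
    where
    back : Fin n → Bool
    back c = (c ∈ᵇ X) ∧ Reach A X c a
    closed : Closed A X back
    closed b c back-b c∈X Abc with ∧-true⁻ {b ∈ᵇ X} back-b
    ... | b∈X , b→a = ∧-true⁺ c∈X
      (reach-trans c b a (reach-closed c c b (reach-self c) b∈X (trans (A-sym c b) Abc)) b→a)

#_ : Bool → ℕ
# true  = 1
# false = 0

countFin : ∀ {n} → (Fin n → Bool) → ℕ
countFin {zero}  p = 0
countFin {suc n} p = # p Fin.zero + countFin (p ∘ Fin.suc)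

countFin-cong : ∀ {n} {p q : Fin n → Bool} → (∀ a → p a ≡ q a) → countFin p ≡ countFin q
countFin-cong {zero}  h = refl
countFin-cong {suc n} h = cong₂ _+_ (cong #_ (h Fin.zero)) (countFin-cong (h ∘ Fin.suc))

except : ∀ {n} → Fin n → (Fin n → Bool) → Fin n → Bool
except v p a = not (a == v) ∧ p a

countFin-point : ∀ {n} (v : Fin n) (p : Fin n → Bool) → countFin p ≡ # p v + countFin (except v p)
countFin-point Fin.zero    p = refl
countFin-point (Fin.suc v) p = begin
  # p Fin.zero + countFin (p ∘ Fin.suc)
    ≡⟨ cong (# p Fin.zero +_) (countFin-point v (p ∘ Fin.suc)) ⟩
  # p Fin.zero + (# p (Fin.suc v) + countFin (except v (p ∘ Fin.suc)))
    ≡⟨ x∙yz≈y∙xz (# p Fin.zero) (# p (Fin.suc v)) _ ⟩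
  # p (Fin.suc v) + (# p Fin.zero + countFin (except v (p ∘ Fin.suc)))
    ≡⟨ cong (λ c → # p (Fin.suc v) + (# p Fin.zero + c))
            (countFin-cong λ a → cong (λ e → not e ∧ p (Fin.suc a)) (sym (==-suc a v))) ⟩
  # p (Fin.suc v) + countFin (except (Fin.suc v) p)
    ∎
  where open ≡-Reasoning

except-cong : ∀ {n} (v : Fin n) {p q : Fin n → Bool} → (∀ a → ¬ a ≡ v → p a ≡ q a) →
              ∀ a → except v p a ≡ except v q a
except-cong v h a with a ≟ v
... | yes _   = refl
... | no  a≢v = cong (true ∧_) (h a a≢v)

countFin-off-point : ∀ {n} (v : Fin n) {p q : Fin n → Bool} → (∀ a → ¬ a ≡ v → p a ≡ q a) →
                     countFin p ≡ # p v + countFin (except v q)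
countFin-off-point v {p} h = trans (countFin-point v p) (cong (# p v +_) (countFin-cong (except-cong v h)))

countFin-off-two-points : ∀ {n} (v w : Fin n) {p q : Fin n → Bool} → ¬ w ≡ v →
  (∀ a → ¬ a ≡ v → ¬ a ≡ w → p a ≡ q a) → # p v + # p w ≡ # q v + # q w →
  countFin p ≡ countFin q
countFin-off-two-points v w {p} {q} w≢v h total = begin
  countFin p                                                  ≡⟨ split p ⟩
  (# p v + # p w) + countFin (except w (except v p))
    ≡⟨ cong₂ _+_ total (countFin-cong (except-cong w h′)) ⟩
  (# q v + # q w) + countFin (except w (except v q))          ≡⟨ split q ⟨
  countFin q                                                  ∎
  where
  open ≡-Reasoning
  except-v-at-w : ∀ r → except v r w ≡ r w
  except-v-at-w r = cong (λ e → not e ∧ r w) (==-false w≢v)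
  split : ∀ r → countFin r ≡ (# r v + # r w) + countFin (except w (except v r))
  split r = begin
    countFin r                                                ≡⟨ countFin-point v r ⟩
    # r v + countFin (except v r)                             ≡⟨ cong (# r v +_) (countFin-point w (except v r)) ⟩
    # r v + (# except v r w + countFin (except w (except v r)))
      ≡⟨ cong (λ b → # r v + (# b + countFin (except w (except v r)))) (except-v-at-w r) ⟩
    # r v + (# r w + countFin (except w (except v r)))        ≡⟨ ℕ.+-assoc (# r v) _ _ ⟨
    (# r v + # r w) + countFin (except w (except v r))        ∎
  h′ : ∀ a → ¬ a ≡ w → except v p a ≡ except v q a
  h′ a a≢w with a ≟ v
  ... | yes _   = refl
  ... | no  a≢v = cong (true ∧_) (h a a≢v a≢w)

-- A relation R "describes the
-- components of X" when it is symmetric and transitive on X and never leaves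
-- X; the components are then counted by their least elements.

record Components {n} (R : Fin n → Fin n → Bool) (X : Subset n) : Set where
  field
    stays      : ∀ a b → a ∈ X → R a b ≡ true → b ∈ X
    symmetric  : ∀ a b → a ∈ X → R a b ≡ true → R b a ≡ true
    transitive : ∀ a b c → R a b ≡ true → R b c ≡ true → R a c ≡ true

isLeast : ∀ {n} → (Fin n → Fin n → Bool) → Subset n → Fin n → Bool
isLeast R X a = (a ∈ᵇ X) ∧ allFin (λ b → not ((toℕ b <ᵇ toℕ a) ∧ R a b))

module _ {n} (R : Fin n → Fin n → Bool) (X : Subset n) where

  isLeast⁺ : ∀ a → a ∈ X → (∀ b → b < a → R a b ≡ true → ⊥) → isLeast R X a ≡ true
  isLeast⁺ a a∈X minimal = ∧-true⁺ a∈X (allFin⁺ _ λ b → not-true⁺ (false-if-not-true λ e →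
    let b<a , Rab = ∧-true⁻ {toℕ b <ᵇ toℕ a} e
    in minimal b (<ᵇ⇒< (toℕ b) (toℕ a) (Equivalence.from T-≡ b<a)) Rab))

  isLeast⁻ : ∀ a → isLeast R X a ≡ true → ∀ b → b < a → R a b ≡ true → ⊥
  isLeast⁻ a least b b<a Rab = true≢false
    (∧-true⁺ (Equivalence.to T-≡ (<⇒<ᵇ b<a)) Rab)
    (not-true⁻ (allFin⁻ _ (proj₂ (∧-true⁻ {a ∈ᵇ X} least)) b))

  isLeast-∉ : ∀ a → a ∉ X → isLeast R X a ≡ false
  isLeast-∉ a a∉X = false-if-not-true λ least → true≢false (proj₁ (∧-true⁻ least)) a∉X

  isLeast-false : ∀ a → a ∈ X → isLeast R X a ≡ false → Σ (Fin n) λ b → b < a × R a b ≡ true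
  isLeast-false a a∈X not-least with anyFin⁻ _ (not-false⁻ (subst (λ x → x ∧ _ ≡ false) a∈X not-least))
  ... | b , e with ∧-true⁻ {toℕ b <ᵇ toℕ a} (trans (sym (not-involutive _)) e)
  ...   | b<a , Rab = b , <ᵇ⇒< (toℕ b) (toℕ a) (Equivalence.from T-≡ b<a) , Rab

  isLeast-cong : ∀ {R′} a → (a ∈ X → ∀ b → R a b ≡ R′ a b) → isLeast R X a ≡ isLeast R′ X a
  isLeast-cong a same with bool-cases (a ∈ᵇ X)
  ... | inj₂ a∉X rewrite a∉X = refl
  ... | inj₁ a∈X = cong ((a ∈ᵇ X) ∧_) (allFin-cong λ b →
    cong (λ r → not ((toℕ b <ᵇ toℕ a) ∧ r)) (same a∈X b))

-- Then v either forms a new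
-- component on its own, or it joins a component that already meets Y.  In
-- the second case the least element of the enlarged component may change
-- (from the least w of its part in Y to v), but the count does not.
module AddVertex {n} (v : Fin n) (Y : Subset n) (v∉Y : v ∉ Y)
  {R₁ R₂ : Fin n → Fin n → Bool}
  (C₁ : Components R₁ (insert v Y)) (C₂ : Components R₂ Y)
  (agree : ∀ a b → a ∈ Y → b ∈ Y → R₁ a b ≡ R₂ a b) where

  open Components C₁ using (stays; symmetric; transitive)
  open Components C₂ using () renaming (stays to stays₂)

  Y′ : Subset n
  Y′ = insert v Y

  least₁ least₂ : Fin n → Bool
  least₁ = isLeast R₁ Y′
  least₂ = isLeast R₂ Y

  v∈Y′ : v ∈ Y′
  v∈Y′ = ∈-insert-self v Y

  Y⊆Y′ : Y ⊆ Y′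
  Y⊆Y′ = ⊆-insert v Y

  ∈Y′⇒∈Y : ∀ a → a ∈ Y′ → ¬ a ≡ v → a ∈ Y
  ∈Y′⇒∈Y a = ∈-insert⁻ v Y a

  ∈Y⇒≢v : ∀ a → a ∈ Y → ¬ a ≡ v
  ∈Y⇒≢v a a∈Y refl = true≢false a∈Y v∉Y

  least-away : ∀ a → ¬ a ≡ v → (a ∈ Y → R₁ a v ≡ false) → least₁ a ≡ least₂ a
  least-away a a≢v away with bool-cases (a ∈ᵇ Y)
  ... | inj₂ a∉Y = trans (isLeast-∉ R₁ Y′ a (∉-insert v Y a a≢v a∉Y)) (sym (isLeast-∉ R₂ Y a a∉Y))
  ... | inj₁ a∈Y = bool-ext
    (λ l₁ → isLeast⁺ R₂ Y a a∈Y λ b b<a R₂ab →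
      isLeast⁻ R₁ Y′ a l₁ b b<a (trans (agree a b a∈Y (stays₂ a b a∈Y R₂ab)) R₂ab))
    (λ l₂ → isLeast⁺ R₁ Y′ a (Y⊆Y′ a a∈Y) λ b b<a R₁ab → smaller l₂ b b<a R₁ab (b ≟ v))
    where
    smaller : least₂ a ≡ true → ∀ b → b < a → R₁ a b ≡ true → Dec (b ≡ v) → ⊥
    smaller _  b _   R₁ab (yes refl) = true≢false R₁ab (away a∈Y)
    smaller l₂ b b<a R₁ab (no b≢v)   = isLeast⁻ R₂ Y a l₂ b b<a
      (trans (sym (agree a b a∈Y (∈Y′⇒∈Y b (stays a b (Y⊆Y′ a a∈Y) R₁ab) b≢v))) R₁ab)

  isolated : (∀ b → b ∈ Y → R₁ v b ≡ false) → countFin least₁ ≡ suc (countFin least₂)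
  isolated alone = begin
    countFin least₁                       ≡⟨ countFin-off-point v others ⟩
    # least₁ v + countFin (except v least₂)
      ≡⟨ cong₂ (λ b c → # b + (# c + countFin (except v least₂))) least₁-v (sym (isLeast-∉ R₂ Y v v∉Y)) ⟩
    suc (# least₂ v + countFin (except v least₂))
      ≡⟨ cong suc (countFin-point v least₂) ⟨
    suc (countFin least₂)                 ∎
    where
    open ≡-Reasoning
    least₁-v : least₁ v ≡ true
    least₁-v = isLeast⁺ R₁ Y′ v v∈Y′ λ b b<v Rvb → with-≟ b b<v Rvb (b ≟ v)
      where
      with-≟ : ∀ b → b < v → R₁ v b ≡ true → Dec (b ≡ v) → ⊥
      with-≟ b b<v _   (yes b≡v) = <⇒≢ b<v b≡v
      with-≟ b _   Rvb (no b≢v)  = true≢false Rvb (alone b (∈Y′⇒∈Y b (stays v b v∈Y′ Rvb) b≢v))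
    others : ∀ a → ¬ a ≡ v → least₁ a ≡ least₂ a
    others a a≢v = least-away a a≢v λ a∈Y → false-if-not-true λ Rav →
      true≢false (symmetric a v (Y⊆Y′ a a∈Y) Rav) (alone a a∈Y)

  joined : ∀ u → u ∈ Y → R₁ v u ≡ true → countFin least₁ ≡ countFin least₂
  joined u u∈Y Rvu = countFin-off-two-points v w w≢v others
    (trans one-of-v-w (cong₂ (λ b c → # b + # c) (sym (isLeast-∉ R₂ Y v v∉Y)) (sym least₂-w)))
    where
    in-class : Fin n → Bool
    in-class c = (c ∈ᵇ Y) ∧ R₁ v c

    lowest : Σ (Fin n) λ w → in-class w ≡ true × (∀ b → b < w → in-class b ≡ false)
    lowest = least in-class u (∧-true⁺ u∈Y Rvu)

    w : Fin n
    w = proj₁ lowest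

    w∈Y : w ∈ Y
    w∈Y = proj₁ (∧-true⁻ (proj₁ (proj₂ lowest)))

    Rvw : R₁ v w ≡ true
    Rvw = proj₂ (∧-true⁻ {w ∈ᵇ Y} (proj₁ (proj₂ lowest)))

    below-w : ∀ b → b < w → b ∈ Y → R₁ v b ≡ true → ⊥
    below-w b b<w b∈Y Rvb = true≢false (∧-true⁺ b∈Y Rvb) (proj₂ (proj₂ lowest) b b<w)

    w≢v : ¬ w ≡ v
    w≢v = ∈Y⇒≢v w w∈Y

    above-w : ∀ a → a ∈ Y → R₁ v a ≡ true → ¬ a ≡ w → w < a
    above-w a a∈Y Rva a≢w with <-cmp a w
    ... | tri< a<w _ _ = ⊥-elim (below-w a a<w a∈Y Rva)
    ... | tri≈ _ a≡w _ = ⊥-elim (a≢w a≡w)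
    ... | tri> _ _ w<a = w<a

    least₂-w : least₂ w ≡ true
    least₂-w = isLeast⁺ R₂ Y w w∈Y λ b b<w R₂wb →
      let b∈Y = stays₂ w b w∈Y R₂wb
      in below-w b b<w b∈Y (transitive v w b Rvw (trans (agree w b w∈Y b∈Y) R₂wb))

    one-of-v-w : # least₁ v + # least₁ w ≡ 1
    one-of-v-w with least₁ v in least₁-v
    ... | true  = cong (suc ∘ #_) least₁-w
      where
      v<w : v < w
      v<w with <-cmp v w
      ... | tri< v<w _ _ = v<w
      ... | tri≈ _ v≡w _ = ⊥-elim (w≢v (sym v≡w))
      ... | tri> _ _ w<v = ⊥-elim (isLeast⁻ R₁ Y′ v least₁-v w w<v Rvw)
      least₁-w : least₁ w ≡ false
      least₁-w = false-if-not-true λ l → isLeast⁻ R₁ Y′ w l v v<w (symmetric v w v∈Y′ Rvw)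
    ... | false = cong #_ least₁-w
      where
      least₁-w : least₁ w ≡ true
      least₁-w = isLeast⁺ R₁ Y′ w (Y⊆Y′ w w∈Y) λ b b<w Rwb → below b b<w Rwb (b ≟ v)
        where
        below : ∀ b → b < w → R₁ w b ≡ true → Dec (b ≡ v) → ⊥
        below b b<w Rwb (no b≢v) =
          below-w b b<w (∈Y′⇒∈Y b (stays w b (Y⊆Y′ w w∈Y) Rwb) b≢v) (transitive v w b Rvw Rwb)
        below b b<w _ (yes refl) with isLeast-false R₁ Y′ v v∈Y′ least₁-v
        ... | c , c<v , Rvc =
          below-w c (<-trans c<v b<w) (∈Y′⇒∈Y c (stays v c v∈Y′ Rvc) (<⇒≢ c<v)) Rvc

    others : ∀ a → ¬ a ≡ v → ¬ a ≡ w → least₁ a ≡ least₂ a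
    others a a≢v a≢w with bool-cases (a ∈ᵇ Y)
    ... | inj₂ a∉Y = least-away a a≢v λ a∈Y → ⊥-elim (true≢false a∈Y a∉Y)
    ... | inj₁ a∈Y with bool-cases (R₁ a v)
    ...   | inj₂ Rav = least-away a a≢v λ _ → Rav
    ...   | inj₁ Rav = trans
      (false-if-not-true λ l₁ → isLeast⁻ R₁ Y′ a l₁ w w<a Raw)
      (sym (false-if-not-true λ l₂ → isLeast⁻ R₂ Y a l₂ w w<a (trans (sym (agree a w a∈Y w∈Y)) Raw)))
      where
      w<a : w < a
      w<a = above-w a a∈Y (symmetric a v (Y⊆Y′ a a∈Y) Rav) a≢w
      Raw : R₁ a w ≡ true
      Raw = transitive a v w Rav Rvw

reach-components : ∀ {n} (A : Fin n → Fin n → Bool) (X : Subset n) → (∀ a b → A a b ≡ A b a) →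
                   Components (Reach A X) X
reach-components A X A-sym = record
  { stays      = reach-stays
  ; symmetric  = reach-sym A-sym
  ; transitive = reach-trans
  }
  where open Reachability A X

k-as-count : ∀ {n} (G : Graph n) X → k G X ≡ countFin (isLeast (Reach (adj G) X) X)
k-as-count {n} G X = count-tabulate (isRep (adj G) X) id
  where
  count-tabulate : ∀ {m} (p : Fin n → Bool) (f : Fin m → Fin n) →
    length (filter (λ a → p a ≟ᵇ true) (List.tabulate f)) ≡ countFin (p ∘ f)
  count-tabulate {zero}  p f = refl
  count-tabulate {suc m} p f with p (f Fin.zero)
  ... | true  = cong suc (count-tabulate p (f ∘ Fin.suc))
  ... | false = count-tabulate p (f ∘ Fin.suc)

reach-local : ∀ {n} {A B : Fin n → Fin n → Bool} {X : Subset n} →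
  (∀ b c → b ∈ X → c ∈ X → A b c ≡ B b c) →
  ∀ a → a ∈ X → ∀ b → Reach A X a b ≡ Reach B X a b
reach-local {A = A} {B} {X} same a a∈X b =
  bool-ext (transfer same b) (transfer (λ b c b∈ c∈ → sym (same b c b∈ c∈)) b)
  where
  transfer : ∀ {A B} → (∀ b c → b ∈ X → c ∈ X → A b c ≡ B b c) →
             ∀ b → Reach A X a b ≡ true → Reach B X a b ≡ true
  transfer {A} {B} same′ = Reachability.reach-least A X (Reach B X a) closed a (Reachability.reach-self B X a)
    where
    closed : Closed A X (Reach B X a)
    closed b c b∈ c∈X Abc = Reachability.reach-closed B X a b c b∈ c∈X
      (trans (sym (same′ b c (Reachability.reach-stays B X a b a∈X b∈) c∈X)) Abc)

k-contract-isolated : ∀ {n} (G : Graph n) v Y → (∀ b → b ∈ Y → adj G v b ≡ false) →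
                      k (G / v) Y ≡ k G Y
k-contract-isolated G v Y no-neighbour = begin
  k (G / v) Y                                   ≡⟨ k-as-count (G / v) Y ⟩
  countFin (isLeast (Reach (contrAdj G v) Y) Y)
    ≡⟨ countFin-cong (λ a →
         isLeast-cong (Reach (contrAdj G v) Y) Y {Reach (adj G) Y} a (reach-local {X = Y} same a)) ⟩
  countFin (isLeast (Reach (adj G) Y) Y)        ≡⟨ k-as-count G Y ⟨
  k G Y                                         ∎
  where
  open ≡-Reasoning
  same : ∀ b c → b ∈ Y → c ∈ Y → contrAdj G v b c ≡ adj G b c
  same b c b∈Y _ rewrite no-neighbour b b∈Y = ∨-identityʳ (adj G b c)

-- The key graph-theoretic fact: for Y ⊆ V - v, two vertices of Y are joined
-- by a walk in G[Y ∪ {v}] exactly when they are joined in (G/v)[Y], since a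
-- passage a → v → b through v becomes the edge ab of G/v and vice versa.
module Contraction {n} (G : Graph n) (v : Fin n) (Y : Subset n) (v∉Y : v ∉ Y) where

  private
    A B : Fin n → Fin n → Bool
    A = adj G
    B = contrAdj G v
    module RA = Reachability A (insert v Y)
    module RB = Reachability B Y

  Y′ : Subset n
  Y′ = insert v Y

  v∈Y′ : v ∈ Y′
  v∈Y′ = ∈-insert-self v Y

  contracted⇒walk : ∀ a b → Reach B Y a b ≡ true → Reach A Y′ a b ≡ true
  contracted⇒walk a = RB.reach-least (Reach A Y′ a) closed a (RA.reach-self a)
    where
    closed : Closed B Y (Reach A Y′ a)
    closed b c a→b c∈Y Bbc with ∨-true⁻ Bbc
    ... | inj₁ Abc = RA.reach-closed a b c a→b (⊆-insert v Y c c∈Y) Abc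
    ... | inj₂ via-v with ∧-true⁻ {A v b} via-v
    ...   | Avb , rest = RA.reach-closed a v c a→v (⊆-insert v Y c c∈Y) (proj₁ (∧-true⁻ rest))
      where
      a→v : Reach A Y′ a v ≡ true
      a→v = RA.reach-closed a b v a→b v∈Y′ (trans (adj-sym G b v) Avb)

  walk⇒contracted : ∀ a b → a ∈ Y → b ∈ Y → Reach A Y′ a b ≡ true → Reach B Y a b ≡ true
  walk⇒contracted a b a∈Y b∈Y a→b with ∨-true⁻ (RA.reach-least reached closed a start b a→b)
    where
    reached : Fin n → Bool
    reached c = ((c ∈ᵇ Y) ∧ Reach B Y a c) ∨ ((c == v) ∧ anyFin (λ d → Reach B Y a d ∧ A v d))

    start : reached a ≡ true
    start = ∨-trueˡ (∧-true⁺ a∈Y (RB.reach-self a))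

    step-from-Y : ∀ b c → Reach B Y a b ≡ true → c ∈ Y′ → A b c ≡ true → reached c ≡ true
    step-from-Y b c a→b c∈Y′ Abc with c ≟ v
    ... | yes refl = ∨-trueʳ {(c ∈ᵇ Y) ∧ Reach B Y a c}
      (anyFin⁺ (λ d → Reach B Y a d ∧ A c d) b (∧-true⁺ a→b (trans (adj-sym G c b) Abc)))
    ... | no c≢v = ∨-trueˡ (∧-true⁺ c∈Y (RB.reach-closed a b c a→b c∈Y (∨-trueˡ Abc)))
      where
      c∈Y : c ∈ Y
      c∈Y = ∈-insert⁻ v Y c c∈Y′ c≢v

    -- an edge leaving v, where v is adjacent to a vertex d reached in (G/v)[Y]:
    -- the path d, v, c is the edge dc of G/v
    step-from-v : ∀ c d → Reach B Y a d ≡ true → A v d ≡ true → c ∈ Y′ → A v c ≡ true → reached c ≡ true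
    step-from-v c d a→d Avd c∈Y′ Avc with c ≟ v
    ... | yes refl = ⊥-elim (true≢false Avc (adj-irrefl G c))
    ... | no c≢v with c ≟ d
    ...   | yes refl = ∨-trueˡ (∧-true⁺ (∈-insert⁻ v Y c c∈Y′ c≢v) a→d)
    ...   | no c≢d = ∨-trueˡ (∧-true⁺ c∈Y (RB.reach-closed a d c a→d c∈Y Bdc))
      where
      c∈Y : c ∈ Y
      c∈Y = ∈-insert⁻ v Y c c∈Y′ c≢v
      Bdc : B d c ≡ true
      Bdc = ∨-trueʳ {A d c} (∧-true⁺ Avd (∧-true⁺ Avc (not-true⁺ (==-false (c≢d ∘ sym)))))

    closed : Closed A Y′ reached
    closed b c reached-b c∈Y′ Abc with ∨-true⁻ reached-b
    ... | inj₁ in-Y = step-from-Y b c (proj₂ (∧-true⁻ {b ∈ᵇ Y} in-Y)) c∈Y′ Abc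
    ... | inj₂ at-v with ∧-true⁻ {b == v} at-v
    ...   | b=v , near with ==-true⁻ b=v | anyFin⁻ _ near
    ...     | refl | d , d-spec with ∧-true⁻ {Reach B Y a d} d-spec
    ...       | a→d , Avd = step-from-v c d a→d Avd c∈Y′ Abc
  ... | inj₁ in-Y = proj₂ (∧-true⁻ {b ∈ᵇ Y} in-Y)
  ... | inj₂ at-v = ⊥-elim (true≢false (subst (_∈ Y) (==-true⁻ (proj₁ (∧-true⁻ at-v))) b∈Y) v∉Y)

  walk⇔contracted : ∀ a b → a ∈ Y → b ∈ Y → Reach A Y′ a b ≡ Reach B Y a b
  walk⇔contracted a b a∈Y b∈Y = bool-ext (walk⇒contracted a b a∈Y b∈Y) (contracted⇒walk a b)

  private
    components-G : Components (Reach A Y′) Y′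
    components-G = reach-components A Y′ (adj-sym G)

    components-G/v : Components (Reach B Y) Y
    components-G/v = reach-components B Y (adj-sym (G / v))

  open AddVertex v Y v∉Y components-G components-G/v walk⇔contracted using (isolated; joined)

  k-insert-joined : ∀ u → u ∈ Y → adj G v u ≡ true → k G Y′ ≡ k (G / v) Y
  k-insert-joined u u∈Y Avu = begin
    k G Y′                                  ≡⟨ k-as-count G Y′ ⟩
    countFin (isLeast (Reach A Y′) Y′)      ≡⟨ joined u u∈Y v→u ⟩
    countFin (isLeast (Reach B Y) Y)        ≡⟨ k-as-count (G / v) Y ⟨
    k (G / v) Y                             ∎
    where
    open ≡-Reasoning
    v→u : Reach A Y′ v u ≡ true
    v→u = RA.reach-closed v v u (RA.reach-self v) (⊆-insert v Y u u∈Y) Avu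

  module _ (no-neighbour : ∀ b → b ∈ Y → adj G v b ≡ false) where

    k-insert-isolated : k G Y′ ≡ suc (k G Y)
    k-insert-isolated = begin
      k G Y′                                ≡⟨ k-as-count G Y′ ⟩
      countFin (isLeast (Reach A Y′) Y′)    ≡⟨ isolated alone ⟩
      suc (countFin (isLeast (Reach B Y) Y)) ≡⟨ cong suc (k-as-count (G / v) Y) ⟨
      suc (k (G / v) Y)                     ≡⟨ cong suc (k-contract-isolated G v Y no-neighbour) ⟩
      suc (k G Y)                           ∎
      where
      open ≡-Reasoning
      only-v : Closed A Y′ (_== v)
      only-v b c b=v c∈Y′ Abc with ==-true⁻ b=v | c ≟ v
      ... | refl | yes refl = refl
      ... | refl | no c≢v   = ⊥-elim (true≢false Abc (no-neighbour c (∈-insert⁻ v Y c c∈Y′ c≢v)))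
      alone : ∀ b → b ∈ Y → Reach A Y′ v b ≡ false
      alone b b∈Y = false-if-not-true λ v→b →
        true≢false (subst (_∈ Y) (==-true⁻ (RA.reach-least (_== v) only-v v (==-refl v) b v→b)) b∈Y) v∉Y

countSubsets : ∀ {n} → (Subset n → Bool) → ℕ
countSubsets {zero}  P = # P []
countSubsets {suc n} P = countSubsets (P ∘ (true ∷_)) + countSubsets (P ∘ (false ∷_))

countSubsets-cong : ∀ {n} {P P′ : Subset n → Bool} → (∀ X → P X ≡ P′ X) →
                    countSubsets P ≡ countSubsets P′
countSubsets-cong {zero}  h = cong #_ (h [])
countSubsets-cong {suc n} h =
  cong₂ _+_ (countSubsets-cong (h ∘ (true ∷_))) (countSubsets-cong (h ∘ (false ∷_)))

countSubsets-none : ∀ {n} {P : Subset n → Bool} → (∀ X → P X ≡ false) → countSubsets P ≡ 0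
countSubsets-none {zero}  h = cong #_ (h [])
countSubsets-none {suc n} h =
  cong₂ _+_ (countSubsets-none (h ∘ (true ∷_))) (countSubsets-none (h ∘ (false ∷_)))

countSubsets-split : ∀ {n} (q P : Subset n → Bool) →
  countSubsets P ≡ countSubsets (λ X → q X ∧ P X) + countSubsets (λ X → not (q X) ∧ P X)
countSubsets-split {zero}  q P = split (q []) (P [])
  where
  split : ∀ b p → # p ≡ # (b ∧ p) + # (not b ∧ p)
  split true  p = sym (ℕ.+-identityʳ (# p))
  split false p = refl
countSubsets-split {suc n} q P = trans
  (cong₂ _+_ (countSubsets-split (q ∘ (true ∷_)) (P ∘ (true ∷_)))
             (countSubsets-split (q ∘ (false ∷_)) (P ∘ (false ∷_))))
  (interchange (with-q true) (without-q true) (with-q false) (without-q false))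
  where
  with-q without-q : Bool → ℕ
  with-q    b = countSubsets (λ X → q (b ∷ X) ∧ P (b ∷ X))
  without-q b = countSubsets (λ X → not (q (b ∷ X)) ∧ P (b ∷ X))

countSubsets-insert : ∀ {n} (v : Fin n) (P : Subset n → Bool) →
  countSubsets (λ X → (v ∈ᵇ X) ∧ P X) ≡ countSubsets (λ Y → not (v ∈ᵇ Y) ∧ P (insert v Y))
countSubsets-insert Fin.zero    P = ℕ.+-comm (countSubsets (P ∘ (true ∷_))) _
countSubsets-insert (Fin.suc v) P =
  cong₂ _+_ (countSubsets-insert v (P ∘ (true ∷_))) (countSubsets-insert v (P ∘ (false ∷_)))

size-insert : ∀ {n} (v : Fin n) Y → v ∉ Y → size (insert v Y) ≡ suc (size Y)
size-insert Fin.zero    (false ∷ Y) _   = refl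
size-insert (Fin.suc v) (true  ∷ Y) v∉Y = cong suc (size-insert v Y v∉Y)
size-insert (Fin.suc v) (false ∷ Y) v∉Y = size-insert v Y v∉Y

counted : ∀ {n} → Graph n → ℕ → ℕ → Subset n → Bool
counted G i j X = (X ⊆ᵇ V G) ∧ (size X ≡ᵇ i) ∧ (k G X ≡ᵇ j)

Q-as-count : ∀ {n} (G : Graph n) i j → Q G i j ≡ pos (countSubsets (counted G i j))
Q-as-count {n} G i j = cong pos (count-list (counted G i j))
  where
  count-map : ∀ {m} (P : Subset (suc m) → Bool) b (Xs : List.List (Subset m)) →
    length (filter (λ X → P X ≟ᵇ true) (List.map (b ∷_) Xs))
      ≡ length (filter (λ X → P (b ∷ X) ≟ᵇ true) Xs)
  count-map P b List.[] = refl
  count-map P b (X List.∷ Xs) with P (b ∷ X)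
  ... | true  = cong suc (count-map P b Xs)
  ... | false = count-map P b Xs
  count-list : ∀ {m} (P : Subset m → Bool) →
    length (filter (λ X → P X ≟ᵇ true) (subsets m)) ≡ countSubsets P
  count-list {zero} P with P []
  ... | true  = refl
  ... | false = refl
  count-list {suc m} P = begin
    length (filter P? (List.map (true ∷_) (subsets m) List.++ List.map (false ∷_) (subsets m)))
      ≡⟨ cong length (filter-++ P? (List.map (true ∷_) (subsets m)) _) ⟩
    length (filter P? (List.map (true ∷_) (subsets m)) List.++ filter P? (List.map (false ∷_) (subsets m)))
      ≡⟨ length-++ (filter P? (List.map (true ∷_) (subsets m))) ⟩
    length (filter P? (List.map (true ∷_) (subsets m))) + length (filter P? (List.map (false ∷_) (subsets m)))
      ≡⟨ cong₂ _+_ (trans (count-map P true (subsets m)) (count-list (P ∘ (true ∷_))))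
                   (trans (count-map P false (subsets m)) (count-list (P ∘ (false ∷_)))) ⟩
    countSubsets P ∎
    where
    open ≡-Reasoning
    P? : Decidable (λ X → P X ≡ true)
    P? X = P X ≟ᵇ true

#Q : ∀ {n} → Graph n → ℕ → ℕ → ℕ
#Q G i j = countSubsets (counted G i j)

module Recurrence {n} (G : Graph n) (v : Fin n) (v∈V : v ∈ V G) where

  W : Subset n
  W = V (G -v v)

  ∈W⁻ : ∀ a → a ∈ W → a ∈ V G × ¬ a ≡ v
  ∈W⁻ a a∈W with ∧-true⁻ (trans (sym (∈-removeSet (V G) (_== v) a)) a∈W)
  ... | a∈V , a≠v = a∈V , λ { refl → true≢false (==-refl a) (not-true⁻ a≠v) }

  ∈W⁺ : ∀ a → a ∈ V G → ¬ a ≡ v → a ∈ W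
  ∈W⁺ a a∈V a≢v = trans (∈-removeSet (V G) (_== v) a) (∧-true⁺ a∈V (not-true⁺ (==-false a≢v)))

  v∉⊆W : ∀ Y → (Y ⊆ᵇ W) ≡ true → v ∉ Y
  v∉⊆W Y Y⊆W = false-if-not-true λ v∈Y → proj₂ (∈W⁻ v (⊆ᵇ⁻ Y W Y⊆W v v∈Y)) refl

  touches : Subset n → Bool
  touches Y = anyFin (λ a → (a ∈ᵇ Y) ∧ adj G v a)

  untouched : ∀ Y → touches Y ≡ false → ∀ b → b ∈ Y → adj G v b ≡ false
  untouched Y none b b∈Y = false-if-not-true λ Avb → true≢false (anyFin⁺ _ b (∧-true⁺ b∈Y Avb)) none

  sets-of-G-v : ∀ X → not (v ∈ᵇ X) ∧ (X ⊆ᵇ V G) ≡ (X ⊆ᵇ W)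
  sets-of-G-v X = bool-ext
    (λ e → let v∉X , X⊆V = ∧-true⁻ e in ⊆ᵇ⁺ X W λ a a∈X →
      ∈W⁺ a (⊆ᵇ⁻ X (V G) X⊆V a a∈X) λ { refl → true≢false a∈X (not-true⁻ v∉X) })
    (λ X⊆W → ∧-true⁺ (not-true⁺ (v∉⊆W X X⊆W))
      (⊆ᵇ⁺ X (V G) λ a a∈X → proj₁ (∈W⁻ a (⊆ᵇ⁻ X W X⊆W a a∈X))))

  sets-of-G-insert : ∀ Y → v ∉ Y → (insert v Y ⊆ᵇ V G) ≡ (Y ⊆ᵇ W)
  sets-of-G-insert Y v∉Y = bool-ext
    (λ Y′⊆V → ⊆ᵇ⁺ Y W λ a a∈Y →
      ∈W⁺ a (⊆ᵇ⁻ (insert v Y) (V G) Y′⊆V a (⊆-insert v Y a a∈Y)) λ { refl → true≢false a∈Y v∉Y })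
    (λ Y⊆W → ⊆ᵇ⁺ (insert v Y) (V G) λ a a∈Y′ → in-V Y⊆W a a∈Y′ (a ≟ v))
    where
    in-V : (Y ⊆ᵇ W) ≡ true → ∀ a → a ∈ insert v Y → Dec (a ≡ v) → a ∈ V G
    in-V _   a _    (yes refl) = v∈V
    in-V Y⊆W a a∈Y′ (no a≢v)   = proj₁ (∈W⁻ a (⊆ᵇ⁻ Y W Y⊆W a (∈-insert⁻ v Y a a∈Y′ a≢v)))

  N[v] : Fin n → Bool
  N[v] a = (a == v) ∨ ((a ∈ᵇ V G) ∧ adj G v a)

  ∈V-N⁻ : ∀ a → a ∈ V (G -N[ v ]) → a ∈ V G × N[v] a ≡ false
  ∈V-N⁻ a a∈ with ∧-true⁻ (trans (sym (∈-removeSet (V G) N[v] a)) a∈)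
  ... | a∈V , a∉N[v] = a∈V , not-true⁻ a∉N[v]

  sets-of-G-N : ∀ Y → not (touches Y) ∧ (Y ⊆ᵇ W) ≡ (Y ⊆ᵇ V (G -N[ v ]))
  sets-of-G-N Y = bool-ext to from
    where
    to : not (touches Y) ∧ (Y ⊆ᵇ W) ≡ true → (Y ⊆ᵇ V (G -N[ v ])) ≡ true
    to e = ⊆ᵇ⁺ Y (V (G -N[ v ])) in-G-N
      where
      in-G-N : Y ⊆ V (G -N[ v ])
      in-G-N a a∈Y with ∧-true⁻ e
      ... | untouched-Y , Y⊆W with ∈W⁻ a (⊆ᵇ⁻ Y W Y⊆W a a∈Y) | untouched Y (not-true⁻ untouched-Y) a a∈Y
      ...   | a∈V , a≢v | Ava = trans (∈-removeSet (V G) N[v] a) (∧-true⁺ a∈V (not-true⁺ a∉N[v]))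
        where
        a∉N[v] : N[v] a ≡ false
        a∉N[v] rewrite ==-false a≢v | Ava = ∧-zeroʳ (a ∈ᵇ V G)

    from : (Y ⊆ᵇ V (G -N[ v ])) ≡ true → not (touches Y) ∧ (Y ⊆ᵇ W) ≡ true
    from Y⊆VN = ∧-true⁺ (not-true⁺ no-touch) (⊆ᵇ⁺ Y W in-W)
      where
      in-G-N : Y ⊆ V (G -N[ v ])
      in-G-N = ⊆ᵇ⁻ Y (V (G -N[ v ])) Y⊆VN
      no-touch : touches Y ≡ false
      no-touch = false-if-not-true λ t →
        let a , a-spec = anyFin⁻ _ t ; a∈Y , Ava = ∧-true⁻ a-spec ; a∈V , a∉N[v] = ∈V-N⁻ a (in-G-N a a∈Y)
        in true≢false (∨-trueʳ {a == v} (∧-true⁺ a∈V Ava)) a∉N[v]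
      in-W : Y ⊆ W
      in-W a a∈Y = let a∈V , a∉N[v] = ∈V-N⁻ a (in-G-N a a∈Y) in
        ∈W⁺ a a∈V λ { refl → true≢false (∨-trueˡ (==-refl a)) a∉N[v] }

  extension : ℕ → ℕ → Subset n → Bool
  extension i j Y = (Y ⊆ᵇ W) ∧ (size Y ≡ᵇ i) ∧ (k G (insert v Y) ≡ᵇ j)

  through-v : ∀ i j → countSubsets (λ X → (v ∈ᵇ X) ∧ counted G i j X)
                    ≡ countSubsets (λ Y → not (v ∈ᵇ Y) ∧ counted G i j (insert v Y))
  through-v i j = countSubsets-insert v (counted G i j)

  avoiding-v : ∀ i j → countSubsets (λ X → not (v ∈ᵇ X) ∧ counted G i j X) ≡ #Q (G -v v) i j
  avoiding-v i j = countSubsets-cong λ X → trans (sym (∧-assoc (not (v ∈ᵇ X)) _ _))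
    (cong (_∧ ((size X ≡ᵇ i) ∧ (k G X ≡ᵇ j))) (sets-of-G-v X))

  -- no vertex set through v is empty
  count-G-zero : ∀ j → #Q G 0 j ≡ #Q (G -v v) 0 j
  count-G-zero j = begin
    #Q G 0 j
      ≡⟨ countSubsets-split (v ∈ᵇ_) (counted G 0 j) ⟩
    countSubsets (λ X → (v ∈ᵇ X) ∧ counted G 0 j X)
      + countSubsets (λ X → not (v ∈ᵇ X) ∧ counted G 0 j X)
      ≡⟨ cong₂ _+_ (trans (through-v 0 j) (countSubsets-none nonempty)) (avoiding-v 0 j) ⟩
    #Q (G -v v) 0 j ∎
    where
    open ≡-Reasoning
    nonempty : ∀ Y → not (v ∈ᵇ Y) ∧ counted G 0 j (insert v Y) ≡ false
    nonempty Y = begin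
      not (v ∈ᵇ Y) ∧ counted G 0 j (insert v Y)
        ≡⟨ ∧-cong-if (not (v ∈ᵇ Y)) (λ v∉Y →
             cong (λ s → (insert v Y ⊆ᵇ V G) ∧ (s ≡ᵇ 0) ∧ (k G (insert v Y) ≡ᵇ j))
                  (size-insert v Y (not-true⁻ v∉Y))) ⟩
      not (v ∈ᵇ Y) ∧ ((insert v Y ⊆ᵇ V G) ∧ false)
        ≡⟨ cong (not (v ∈ᵇ Y) ∧_) (∧-zeroʳ (insert v Y ⊆ᵇ V G)) ⟩
      not (v ∈ᵇ Y) ∧ false
        ≡⟨ ∧-zeroʳ (not (v ∈ᵇ Y)) ⟩
      false ∎

  count-G-suc : ∀ i j → #Q G (suc i) j ≡ #Q (G -v v) (suc i) j + countSubsets (extension i j)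
  count-G-suc i j = begin
    #Q G (suc i) j
      ≡⟨ countSubsets-split (v ∈ᵇ_) (counted G (suc i) j) ⟩
    countSubsets (λ X → (v ∈ᵇ X) ∧ counted G (suc i) j X)
      + countSubsets (λ X → not (v ∈ᵇ X) ∧ counted G (suc i) j X)
      ≡⟨ cong₂ _+_ (trans (through-v (suc i) j) (countSubsets-cong as-extension)) (avoiding-v (suc i) j) ⟩
    countSubsets (extension i j) + #Q (G -v v) (suc i) j
      ≡⟨ ℕ.+-comm (countSubsets (extension i j)) _ ⟩
    #Q (G -v v) (suc i) j + countSubsets (extension i j) ∎
    where
    open ≡-Reasoning
    as-extension : ∀ Y → not (v ∈ᵇ Y) ∧ counted G (suc i) j (insert v Y) ≡ extension i j Y
    as-extension Y = trans
      (∧-cong-if (not (v ∈ᵇ Y)) λ v∉Y → cong₂ (λ sub s → sub ∧ (s ≡ᵇ suc i) ∧ (k G (insert v Y) ≡ᵇ j))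
        (sets-of-G-insert Y (not-true⁻ v∉Y)) (size-insert v Y (not-true⁻ v∉Y)))
      (∧-absorb λ ext → not-true⁺ (v∉⊆W Y (proj₁ (∧-true⁻ ext))))

  within-G-N : ∀ Y rest → not (touches Y) ∧ ((Y ⊆ᵇ W) ∧ rest) ≡ (Y ⊆ᵇ V (G -N[ v ])) ∧ rest
  within-G-N Y rest = trans (sym (∧-assoc (not (touches Y)) (Y ⊆ᵇ W) rest)) (cong (_∧ rest) (sets-of-G-N Y))

  count-touching : ∀ i j →
    countSubsets (λ Y → touches Y ∧ extension i j Y) + #Q (G -N[ v ]) i j ≡ #Q (G / v) i j
  count-touching i j = sym (trans (countSubsets-split touches (counted (G / v) i j))
    (cong₂ _+_ (countSubsets-cong joined) (countSubsets-cong isolated)))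
    where
    joined : ∀ Y → touches Y ∧ counted (G / v) i j Y ≡ touches Y ∧ extension i j Y
    joined Y = ∧-cong-if (touches Y) λ t → ∧-cong-if (Y ⊆ᵇ W) λ Y⊆W →
      let u , u-spec = anyFin⁻ _ t ; u∈Y , Avu = ∧-true⁻ u-spec
      in cong (λ m → (size Y ≡ᵇ i) ∧ (m ≡ᵇ j))
              (sym (Contraction.k-insert-joined G v Y (v∉⊆W Y Y⊆W) u u∈Y Avu))
    isolated : ∀ Y → not (touches Y) ∧ counted (G / v) i j Y ≡ counted (G -N[ v ]) i j Y
    isolated Y = trans
      (∧-cong-if (not (touches Y)) λ nt → cong (λ m → (Y ⊆ᵇ W) ∧ (size Y ≡ᵇ i) ∧ (m ≡ᵇ j))
        (k-contract-isolated G v Y (untouched Y (not-true⁻ nt))))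
      (within-G-N Y _)

  as-isolated : ∀ i j Y → not (touches Y) ∧ extension i j Y
                        ≡ not (touches Y) ∧ ((Y ⊆ᵇ W) ∧ (size Y ≡ᵇ i) ∧ (suc (k G Y) ≡ᵇ j))
  as-isolated i j Y = ∧-cong-if (not (touches Y)) λ nt → ∧-cong-if (Y ⊆ᵇ W) λ Y⊆W →
    cong (λ m → (size Y ≡ᵇ i) ∧ (m ≡ᵇ j))
      (Contraction.k-insert-isolated G v Y (v∉⊆W Y Y⊆W) (untouched Y (not-true⁻ nt)))

  count-avoiding : ∀ i j →
    pos (countSubsets (λ Y → not (touches Y) ∧ extension i j Y)) ≡ mulY (Q (G -N[ v ])) i j
  count-avoiding i zero    = cong pos (countSubsets-none λ Y →
    trans (as-isolated i 0 Y) (false-at-end (not (touches Y)) (Y ⊆ᵇ W) (size Y ≡ᵇ i)))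
  count-avoiding i (suc j) = begin
    pos (countSubsets (λ Y → not (touches Y) ∧ extension i (suc j) Y))
      ≡⟨ cong pos (countSubsets-cong λ Y → trans (as-isolated i (suc j) Y) (within-G-N Y _)) ⟩
    pos (#Q (G -N[ v ]) i j)
      ≡⟨ Q-as-count (G -N[ v ]) i j ⟨
    Q (G -N[ v ]) i j ∎
    where open ≡-Reasoning

rearrange : ∀ a e₁ e₀ c →
  pos (a + (e₁ + e₀)) ≡ (pos a +ℤ (pos e₀ -ℤ pos c)) +ℤ pos (e₁ + c)
rearrange a e₁ e₀ c = begin
  pos (a + (e₁ + e₀))                               ≡⟨ pos-+ a (e₁ + e₀) ⟩
  pos a +ℤ pos (e₁ + e₀)                            ≡⟨ cong (pos a +ℤ_) (pos-+ e₁ e₀) ⟩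
  pos a +ℤ (pos e₁ +ℤ pos e₀)                       ≡⟨ ring (pos a) (pos e₁) (pos e₀) (pos c) ⟩
  (pos a +ℤ (pos e₀ -ℤ pos c)) +ℤ (pos e₁ +ℤ pos c) ≡⟨ cong (λ t → (pos a +ℤ (pos e₀ -ℤ pos c)) +ℤ t) (pos-+ e₁ c) ⟨
  (pos a +ℤ (pos e₀ -ℤ pos c)) +ℤ pos (e₁ + c)      ∎
  where
  open ≡-Reasoning
  ring : ∀ x y z w → x +ℤ (y +ℤ z) ≡ (x +ℤ (z -ℤ w)) +ℤ (y +ℤ w)
  ring = solve-∀

theorem5p2 : ∀ {n} (G : Graph n) (v : Fin n) → (v ∈ᵇ V G) ≡ true →
    ∀ (i j : ℕ) →
      Q G i j
        ≡ (Q (G -v v) ⊕ mulX (mulY (Q (G -N[ v ])) ⊖ Q (G -N[ v ])) ⊕ mulX (Q (G / v))) i j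
theorem5p2 G v v∈V zero j = begin
  Q G 0 j                           ≡⟨ Q-as-count G 0 j ⟩
  pos (#Q G 0 j)                    ≡⟨ cong pos (count-G-zero j) ⟩
  pos (#Q (G -v v) 0 j)             ≡⟨ Q-as-count (G -v v) 0 j ⟨
  Q (G -v v) 0 j                    ≡⟨ trans (ℤ.+-identityʳ _) (ℤ.+-identityʳ _) ⟨
  (Q (G -v v) 0 j +ℤ pos 0) +ℤ pos 0 ∎
  where open ≡-Reasoning ; open Recurrence G v v∈V
theorem5p2 G v v∈V (suc i) j = begin
  Q G (suc i) j                                       ≡⟨ Q-as-count G (suc i) j ⟩
  pos (#Q G (suc i) j)                                ≡⟨ cong pos split ⟩
  pos (a + (e₁ + e₀))                                 ≡⟨ rearrange a e₁ e₀ c ⟩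
  (pos a +ℤ (pos e₀ -ℤ pos c)) +ℤ pos (e₁ + c)
    ≡⟨ cong₂ (λ p m → (p +ℤ (m -ℤ pos c)) +ℤ pos (e₁ + c))
             (Q-as-count (G -v v) (suc i) j) (sym (count-avoiding i j)) ⟨
  (Q (G -v v) (suc i) j +ℤ (mulY QN i j -ℤ pos c)) +ℤ pos (e₁ + c)
    ≡⟨ cong₂ (λ m d → (Q (G -v v) (suc i) j +ℤ (mulY QN i j -ℤ m)) +ℤ d)
             (Q-as-count (G -N[ v ]) i j)
             (trans (Q-as-count (G / v) i j) (cong pos (sym (count-touching i j)))) ⟨
  (Q (G -v v) (suc i) j +ℤ (mulY QN i j -ℤ QN i j)) +ℤ Q (G / v) i j ∎
  where
  open ≡-Reasoning
  open Recurrence G v v∈V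
  QN : Poly
  QN = Q (G -N[ v ])
  a e₁ e₀ c : ℕ
  a  = #Q (G -v v) (suc i) j
  e₁ = countSubsets (λ Y → touches Y ∧ extension i j Y)
  e₀ = countSubsets (λ Y → not (touches Y) ∧ extension i j Y)
  c  = #Q (G -N[ v ]) i j
  split : #Q G (suc i) j ≡ a + (e₁ + e₀)
  split = trans (count-G-suc i j) (cong (a +_) (countSubsets-split touches (extension i j)))
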